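{- Let $\mathcal{A}=\langle\Sigma,\mathcal{Q},q^0,\mathcal{F},\delta\rangle$ be a (deterministic or nondeterministic) finite automaton with $q^0\in\mathcal{Q}$, $\mathcal{F}\subseteq\mathcal{Q}$, $\delta\subseteq\mathcal{Q}\times\Sigma\times\mathcal{Q}$, where the elements of $\Sigma$ and $\mathcal{Q}$ are treated as propositional variables. There exists a formula $\psi_{\mathcal{A}}$ of the logic of subintervals over the variables $\mathcal{Q}\cup\Sigma\cup\{L,R,s_0,s_1,s_2\}$ such that, for every model $M$ over a finite order and every interval $[a,b]$ satisfying the orientation assumptions of the context, $\psi_{\mathcal{A}}$ can be made true at $[a,b]$ by a suitable choice of the valuation of the variables from $\mathcal{Q}$ (the labeling of the other variables being kept) if and only if the word over $\Sigma$ written in the leaves of $[a,b]$, read from the leaf labeled $L$ to the leaf labeled $R$, belongs to the language accepted by $\mathcal{A}$.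
   Context: Logic of subintervals: for a finite total order $\mathbb{D}$, intervals are pairs $[a,b]$ with $a\le b$ in $\mathbb{D}$; a labeling $\gamma$ assigns to each interval a set of propositional variables; $M,[a,b]\models v$ iff $v\in\gamma([a,b])$, Boolean connectives as usual, and $M,[a,b]\models\langle D\rangle\psi$ iff some interval $[a',b']\ne[a,b]$ with $a\le a'$, $b'\le b$ satisfies $\psi$. A leaf is an interval $[c,c]$. Orientation assumptions (standing assumption of the paper: models satisfying the orientation formula): exactly one of the leaves $[a,a],[b,b]$ is labeled $L$ and the other is labeled $R$, and no other subinterval of $[a,b]$ is labeled $L$ or $R$; each leaf of $[a,b]$ is labeled with exactly one of $s_0,s_1,s_2$, only leaves are labeled with $s_0,s_1,s_2$, and, numbering the leaves $0,1,2,\dots$ starting from the leaf labeled $L$, the $i$-th leaf is labeled $s_{i\bmod 3}$. "The word written in the leaves" means that each leaf of $[a,b]$ is labeled with exactly one variable from $\Sigma$ (and no non-leaf subinterval of $[a,b]$ is labeled with a variable from $\Sigma$); the word is the sequence of these letters from the $L$-leaf to the $R$-leaf. -}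

module Defs where

open import Data.Nat using (ℕ; zero; suc; _∸_; _%_)
open import Data.Fin using (Fin; toℕ; _≤_)
open import Data.Bool using (Bool; true; false)
open import Data.List using (List; []; _∷_; length)
open import Data.Product using (Σ; ∃; _×_; _,_)
open import Data.Empty using (⊥)
open import Relation.Binary.PropositionalEquality using (_≡_; _≢_)
open import Relation.Nullary using (¬_)
open import Function.Bundles using (_⇔_)

-- Finite automata: alphabet Σ = Fin m, states Q = Fin k.
-- δ ⊆ Q × Σ × Q and F ⊆ Q are given by their characteristic functions.

record Automaton (m k : ℕ) : Set where
  field
    q0 : Fin k
    F  : Fin k → Bool
    δ  : Fin k → Fin m → Fin k → Bool

open Automaton public

-- Acceptance (nondeterministic semantics; covers deterministic automata).
AcceptsFrom : ∀ {m k} → Automaton m k → Fin k → List (Fin m) → Set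
AcceptsFrom A q []      = F A q ≡ true
AcceptsFrom A q (x ∷ w) = ∃ λ q' → (δ A q x q' ≡ true) × AcceptsFrom A q' w

Accepts : ∀ {m k} → Automaton m k → List (Fin m) → Set
Accepts A w = AcceptsFrom A (q0 A) w

data Var (m k : ℕ) : Set where
  sym : Fin m → Var m k
  st  : Fin k → Var m k
  L R : Var m k
  s   : Fin 3 → Var m k

data Formula (V : Set) : Set where
  var  : V → Formula V
  ⊤f   : Formula V
  ¬f_  : Formula V → Formula V
  _∧f_ : Formula V → Formula V → Formula V
  _∨f_ : Formula V → Formula V → Formula V
  ⟨D⟩_ : Formula V → Formula V

-- Models over the finite total order Fin n.  A labeling assigns to each
-- pair (c , d) a set of variables (values at c > d are irrelevant).

Labeling : ℕ → Set → Set
Labeling n V = Fin n → Fin n → V → Bool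

Sat : ∀ {n V} → Labeling n V → Fin n → Fin n → Formula V → Set
Sat γ a b (var v)   = γ a b v ≡ true
Sat γ a b ⊤f        = Data.Unit.⊤ where import Data.Unit
Sat γ a b (¬f φ)    = ¬ Sat γ a b φ
Sat γ a b (φ ∧f ψ)  = Sat γ a b φ × Sat γ a b ψ
Sat γ a b (φ ∨f ψ)  = Sat γ a b φ Data.Sum.⊎ Sat γ a b ψ where import Data.Sum
Sat γ a b (⟨D⟩ φ)   =
  ∃ λ a' → ∃ λ b' → (a ≤ a') × (a' ≤ b') × (b' ≤ b)
    × ¬ ((a' ≡ a) × (b' ≡ b)) × Sat γ a' b' φ

updQ : ∀ {n m k} → Labeling n (Var m k) → (Fin n → Fin n → Fin k → Bool)
     → Labeling n (Var m k)
updQ γ ρ c d (st q) = ρ c d q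
updQ γ ρ c d v      = γ c d v

data Dir : Set where
  L-at-a L-at-b : Dir

Lpt Rpt : ∀ {n} → Dir → Fin n → Fin n → Fin n
Lpt L-at-a a b = a
Lpt L-at-b a b = b
Rpt L-at-a a b = b
Rpt L-at-b a b = a

-- Position (0,1,2,…) of the leaf [c , c], counted from the L-leaf.
pos : ∀ {n} → Dir → Fin n → Fin n → Fin n → ℕ
pos L-at-a a b c = toℕ c ∸ toℕ a
pos L-at-b a b c = toℕ b ∸ toℕ c

record Oriented {n m k} (dir : Dir) (γ : Labeling n (Var m k))
                (a b : Fin n) : Set where
  field
    L-leaf : γ (Lpt dir a b) (Lpt dir a b) L ≡ true
    R-leaf : γ (Rpt dir a b) (Rpt dir a b) R ≡ true
    L-only : ∀ c d → a ≤ c → c ≤ d → d ≤ b → γ c d L ≡ true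
             → (c ≡ Lpt dir a b) × (d ≡ Lpt dir a b)
    R-only : ∀ c d → a ≤ c → c ≤ d → d ≤ b → γ c d R ≡ true
             → (c ≡ Rpt dir a b) × (d ≡ Rpt dir a b)
    s-leaf : ∀ c → a ≤ c → c ≤ b → ∀ (j : Fin 3)
             → (γ c c (s j) ≡ true) ⇔ (toℕ j ≡ pos dir a b c % 3)
    s-only : ∀ c d → a ≤ c → c ≤ d → d ≤ b → c ≢ d → ∀ (j : Fin 3)
             → γ c d (s j) ≡ false

_!_≐_ : ∀ {A : Set} → List A → ℕ → A → Set
[]       ! i     ≐ x = ⊥
(y ∷ ys) ! zero  ≐ x = y ≡ x
(y ∷ ys) ! suc i ≐ x = ys ! i ≐ x

record Written {n m k} (dir : Dir) (γ : Labeling n (Var m k))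
               (a b : Fin n) (w : List (Fin m)) : Set where
  field
    len      : length w ≡ suc (toℕ b ∸ toℕ a)
    leaves   : ∀ c → a ≤ c → c ≤ b → ∀ (x : Fin m)
               → (γ c c (sym x) ≡ true) ⇔ (w ! pos dir a b c ≐ x)
    nonleaf  : ∀ c d → a ≤ c → c ≤ d → d ≤ b → c ≢ d → ∀ (x : Fin m)
               → γ c d (sym x) ≡ false

-- The state variables guess a run of the automaton: the leaf at position p from L carries
-- the state reached after reading the letter at p.  ψ says that no subinterval has a local
-- defect: a leaf without a state, an L-leaf whose state is not reachable from q⁰ by its letter,
-- an R-leaf with a non-final state, or a two-point interval whose leaves, labelled s_j and
-- s_(j+1), carry states q and q' and the second one the letter x, with (q , x , q') ∉ δ.
-- The labels s_(p mod 3) make the leaf labelled s_(j+1) the successor (towards R) of the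
-- one labelled s_j whenever the two are adjacent, so the defect-free valuations of the state
-- variables are exactly the accepting runs on the word in the leaves.
module Submission where

open import Defs
open import Data.Nat as ℕ using (ℕ; zero; suc; _+_; _∸_; _⊓_; z≤n; s≤s)
import Data.Nat.Properties as ℕₚ
open import Data.Nat.DivMod using (_%_; [m+n]%n≡m%n)
open import Data.Fin as Fin using (Fin; toℕ; fromℕ<; _≤_; _≟_)
open import Data.Fin.Patterns using (0F; 1F; 2F)
import Data.Fin.Properties as Finₚ
open import Data.Bool using (Bool; true; false)
open import Data.Bool.Properties using () renaming (_≟_ to _≟ᵇ_)
open import Data.List using (List; []; _∷_; length)
open import Data.Product using (Σ; ∃; _×_; _,_; proj₁; proj₂)
open import Data.Sum using (_⊎_; inj₁; inj₂)
open import Data.Empty using (⊥-elim)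
open import Data.Unit using (tt)
open import Function using (_∘_)
open import Function.Bundles using (_⇔_; mk⇔; Equivalence)
open import Relation.Nullary using (¬_; yes; no; does)
open import Relation.Nullary.Decidable using (dec-true)
open import Relation.Binary.PropositionalEquality as ≡
  using (_≡_; _≢_; refl; trans; cong; subst)

open Equivalence using (to; from)

module _ {V : Set} where

  ⊥f : Formula V
  ⊥f = ¬f ⊤f

  ⋁ : ∀ k → (Fin k → Formula V) → Formula V
  ⋁ zero    φ = ⊥f
  ⋁ (suc k) φ = φ Fin.zero ∨f ⋁ k (φ ∘ Fin.suc)

  unless : Bool → Formula V → Formula V
  unless true  φ = ⊥f
  unless false φ = φ

  □_ : Formula V → Formula V
  □ φ = φ ∧f (¬f (⟨D⟩ (¬f φ)))

  leaf short : Formula V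
  leaf  = ¬f (⟨D⟩ ⊤f)
  short = ¬f (⟨D⟩ (⟨D⟩ ⊤f))

Adjacent : ∀ {n} → Fin n → Fin n → Set
Adjacent c d = toℕ d ≡ suc (toℕ c)

module _ {n : ℕ} where

  adjacent⇒≤ : {c d : Fin n} → Adjacent c d → c ≤ d
  adjacent⇒≤ adj = ℕₚ.≤-trans (ℕₚ.n≤1+n _) (ℕₚ.≤-reflexive (≡.sym adj))

  adjacent⇒≢ : {c d : Fin n} → Adjacent c d → c ≢ d
  adjacent⇒≢ adj refl = ℕₚ.1+n≢n (≡.sym adj)

  ≤≤suc⇒≡∨≡suc : ∀ {t u} → t ℕ.≤ u → u ℕ.≤ suc t → u ≡ t ⊎ u ≡ suc t
  ≤≤suc⇒≡∨≡suc t≤u u≤1+t with ℕₚ.m≤n⇒m<n∨m≡n u≤1+t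
  ... | inj₁ u<1+t = inj₁ (ℕₚ.≤-antisym (ℕₚ.<⇒≤pred u<1+t) t≤u)
  ... | inj₂ u≡1+t = inj₂ u≡1+t

  between-adjacent : {lo hi c : Fin n} → Adjacent lo hi → lo ≤ c → c ≤ hi → c ≡ lo ⊎ c ≡ hi
  between-adjacent adj lo≤c c≤hi with ≤≤suc⇒≡∨≡suc lo≤c (subst (toℕ _ ℕ.≤_) adj c≤hi)
  ... | inj₁ c≡lo = inj₁ (Finₚ.toℕ-injective c≡lo)
  ... | inj₂ c≡1+lo = inj₂ (Finₚ.toℕ-injective (trans c≡1+lo (≡.sym adj)))

  points-of-short : {c d c₁ c₂ : Fin n} → toℕ d ℕ.≤ suc (toℕ c) →
                    c ≤ c₁ → c₁ ≤ d → c ≤ c₂ → c₂ ≤ d →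
                    c₁ ≡ c₂ ⊎ Adjacent c₁ c₂ ⊎ Adjacent c₂ c₁
  points-of-short d≤1+c c≤c₁ c₁≤d c≤c₂ c₂≤d
    with ≤≤suc⇒≡∨≡suc c≤c₁ (ℕₚ.≤-trans c₁≤d d≤1+c)
       | ≤≤suc⇒≡∨≡suc c≤c₂ (ℕₚ.≤-trans c₂≤d d≤1+c)
  ... | inj₁ e₁ | inj₁ e₂ = inj₁ (Finₚ.toℕ-injective (trans e₁ (≡.sym e₂)))
  ... | inj₂ e₁ | inj₂ e₂ = inj₁ (Finₚ.toℕ-injective (trans e₁ (≡.sym e₂)))
  ... | inj₁ e₁ | inj₂ e₂ = inj₂ (inj₁ (trans e₂ (cong suc (≡.sym e₁))))
  ... | inj₂ e₁ | inj₁ e₂ = inj₂ (inj₂ (trans e₁ (cong suc (≡.sym e₂))))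

module _ {n : ℕ} {V : Set} (γ : Labeling n V) where

  ¬-⋁ : ∀ {a b} k (φ : Fin k → Formula V) →
        (¬ Sat γ a b (⋁ k φ)) ⇔ (∀ i → ¬ Sat γ a b (φ i))
  ¬-⋁ zero    φ = mk⇔ (λ _ ()) (λ _ ¬⊤ → ¬⊤ tt)
  ¬-⋁ (suc k) φ = mk⇔ ⇒ ⇐
    where
    ih = ¬-⋁ k (φ ∘ Fin.suc)
    ⇒ : ¬ Sat γ _ _ (⋁ (suc k) φ) → ∀ i → ¬ Sat γ _ _ (φ i)
    ⇒ ¬∨ Fin.zero    = ¬∨ ∘ inj₁
    ⇒ ¬∨ (Fin.suc i) = to ih (¬∨ ∘ inj₂) i
    ⇐ : (∀ i → ¬ Sat γ _ _ (φ i)) → ¬ Sat γ _ _ (⋁ (suc k) φ)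
    ⇐ ¬φ (inj₁ φ₀) = ¬φ Fin.zero φ₀
    ⇐ ¬φ (inj₂ φₛ) = from ih (¬φ ∘ Fin.suc) φₛ

  ¬-unless : ∀ {a b} β (φ : Formula V) →
             (¬ Sat γ a b (unless β φ)) ⇔ (Sat γ a b φ → β ≡ true)
  ¬-unless true  φ = mk⇔ (λ _ _ → refl) (λ _ ¬⊤ → ¬⊤ tt)
  ¬-unless false φ = mk⇔ (λ ¬φ φ → ⊥-elim (¬φ φ)) ⇐
    where
    ⇐ : (Sat γ _ _ φ → false ≡ true) → ¬ Sat γ _ _ φ
    ⇐ h φ with h φ
    ... | ()

  Sat-□¬ : ∀ {a b} (φ : Formula V) → a ≤ b →
           Sat γ a b (□ (¬f φ)) ⇔ (∀ c d → a ≤ c → c ≤ d → d ≤ b → ¬ Sat γ c d φ)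
  Sat-□¬ {a} {b} φ a≤b = mk⇔ ⇒ ⇐
    where
    ⇒ : Sat γ a b (□ (¬f φ)) → ∀ c d → a ≤ c → c ≤ d → d ≤ b → ¬ Sat γ c d φ
    ⇒ (¬φ , no-sub) c d a≤c c≤d d≤b φcd with c ≟ a | d ≟ b
    ... | yes refl | yes refl = ¬φ φcd
    ... | yes _    | no d≢b   = no-sub (c , d , a≤c , c≤d , d≤b , d≢b ∘ proj₂ , λ ¬φcd → ¬φcd φcd)
    ... | no c≢a   | _        = no-sub (c , d , a≤c , c≤d , d≤b , c≢a ∘ proj₁ , λ ¬φcd → ¬φcd φcd)
    ⇐ : (∀ c d → a ≤ c → c ≤ d → d ≤ b → ¬ Sat γ c d φ) → Sat γ a b (□ (¬f φ))
    ⇐ h = h a b Finₚ.≤-refl a≤b Finₚ.≤-refl ,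
          λ { (c , d , a≤c , c≤d , d≤b , _ , ¬¬φ) → ¬¬φ (h c d a≤c c≤d d≤b) }

  leaf-sat : ∀ c → Sat γ c c leaf
  leaf-sat c (c₁ , d₁ , c≤c₁ , c₁≤d₁ , d₁≤c , proper , _) =
    proper ( Finₚ.≤-antisym (Finₚ.≤-trans c₁≤d₁ d₁≤c) c≤c₁
           , Finₚ.≤-antisym d₁≤c (Finₚ.≤-trans c≤c₁ c₁≤d₁))

  short-sat : ∀ {lo hi} → Adjacent lo hi → Sat γ lo hi short
  short-sat adj (c , d , lo≤c , c≤d , d≤hi , proper , inner)
    with between-adjacent adj lo≤c (Finₚ.≤-trans c≤d d≤hi)
       | between-adjacent adj (Finₚ.≤-trans lo≤c c≤d) d≤hi
  ... | inj₁ refl | inj₁ refl = leaf-sat _ inner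
  ... | inj₂ refl | inj₂ refl = leaf-sat _ inner
  ... | inj₁ refl | inj₂ refl = proper (refl , refl)
  ... | inj₂ refl | inj₁ refl = ℕₚ.n≮n _ (subst (ℕ._≤ toℕ d) adj c≤d)

  short-bound : ∀ {c d} → c ≤ d → Sat γ c d short → toℕ d ℕ.≤ suc (toℕ c)
  short-bound {c} {d} c≤d sh with toℕ d ℕₚ.≤? suc (toℕ c)
  ... | yes d≤1+c = d≤1+c
  ... | no d≰1+c = ⊥-elim (sh ( c , e , Finₚ.≤-refl , adjacent⇒≤ adj , e≤d , e≢d ∘ proj₂
                              , c , c , Finₚ.≤-refl , Finₚ.≤-refl , adjacent⇒≤ adj
                              , adjacent⇒≢ adj ∘ proj₂ , tt))
    where
    1+c<d : suc (toℕ c) ℕ.< toℕ d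
    1+c<d = ℕₚ.≰⇒> d≰1+c
    e : Fin n
    e = fromℕ< (ℕₚ.<-trans 1+c<d (Finₚ.toℕ<n d))
    adj : Adjacent c e
    adj = Finₚ.toℕ-fromℕ< _
    e≤d : e ≤ d
    e≤d = ℕₚ.≤-trans (ℕₚ.≤-reflexive adj) (ℕₚ.<⇒≤ 1+c<d)
    e≢d : e ≢ d
    e≢d e≡d = ℕₚ.<-irrefl (trans (≡.sym adj) (cong toℕ e≡d)) 1+c<d

  ⟨D⟩-endpoint : ∀ {lo hi u} (φ : Formula V) → Adjacent lo hi → u ≡ lo ⊎ u ≡ hi →
                 Sat γ u u φ → Sat γ lo hi (⟨D⟩ φ)
  ⟨D⟩-endpoint φ adj (inj₁ refl) φu =
    _ , _ , Finₚ.≤-refl , Finₚ.≤-refl , adjacent⇒≤ adj , adjacent⇒≢ adj ∘ proj₂ , φu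
  ⟨D⟩-endpoint φ adj (inj₂ refl) φu =
    _ , _ , adjacent⇒≤ adj , Finₚ.≤-refl , Finₚ.≤-refl , adjacent⇒≢ adj ∘ ≡.sym ∘ proj₁ , φu

succ₃ : Fin 3 → Fin 3
succ₃ 0F = 1F
succ₃ 1F = 2F
succ₃ 2F = 0F

mod₃ : ℕ → Fin 3
mod₃ zero    = 0F
mod₃ (suc p) = succ₃ (mod₃ p)

succ₃-fixfree : ∀ j → succ₃ j ≢ j
succ₃-fixfree 0F ()
succ₃-fixfree 1F ()
succ₃-fixfree 2F ()

succ₃²-fixfree : ∀ j → succ₃ (succ₃ j) ≢ j
succ₃²-fixfree 0F ()
succ₃²-fixfree 1F ()
succ₃²-fixfree 2F ()

succ₃³≡id : ∀ j → succ₃ (succ₃ (succ₃ j)) ≡ j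
succ₃³≡id 0F = refl
succ₃³≡id 1F = refl
succ₃³≡id 2F = refl

toℕ-mod₃ : ∀ p → toℕ (mod₃ p) ≡ p % 3
toℕ-mod₃ 0 = refl
toℕ-mod₃ 1 = refl
toℕ-mod₃ 2 = refl
toℕ-mod₃ (suc (suc (suc p))) = begin
  toℕ (succ₃ (succ₃ (succ₃ (mod₃ p)))) ≡⟨ cong toℕ (succ₃³≡id (mod₃ p)) ⟩
  toℕ (mod₃ p)                         ≡⟨ toℕ-mod₃ p ⟩
  p % 3                                ≡⟨ [m+n]%n≡m%n p 3 ⟨
  (p + 3) % 3                          ≡⟨ cong (_% 3) (ℕₚ.+-comm p 3) ⟩
  (3 + p) % 3                          ∎
  where open ≡.≡-Reasoning

mod₃-successor : ∀ {p q} → p ≡ q ⊎ q ≡ suc p ⊎ p ≡ suc q →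
                 mod₃ q ≡ succ₃ (mod₃ p) → q ≡ suc p
mod₃-successor (inj₁ refl)        e = ⊥-elim (succ₃-fixfree _ (≡.sym e))
mod₃-successor (inj₂ (inj₁ q≡1+p)) _ = q≡1+p
mod₃-successor (inj₂ (inj₂ refl)) e = ⊥-elim (succ₃²-fixfree _ (≡.sym e))

!≐⇒<length : ∀ {A : Set} (w : List A) {i x} → w ! i ≐ x → i ℕ.< length w
!≐⇒<length (_ ∷ _) {zero}  _   = s≤s z≤n
!≐⇒<length (_ ∷ w) {suc i} w!i = s≤s (!≐⇒<length w w!i)

-- r p is the state entered on reading the letter at position p.
record AcceptingRun {m k} (A : Automaton m k) (q : Fin k) (w : List (Fin m))
                    (r : ℕ → Fin k) : Set where
  field
    first  : ∀ x → w ! 0 ≐ x → δ A q x (r 0) ≡ true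
    next   : ∀ p x → w ! suc p ≐ x → δ A (r p) x (r (suc p)) ≡ true
    accept : F A (r (ℕ.pred (length w))) ≡ true

module _ {m k} (A : Automaton m k) where

  acceptsFrom⇔run : ∀ {q} w → 0 ℕ.< length w →
                    AcceptsFrom A q w ⇔ ∃ (AcceptingRun A q w)
  acceptsFrom⇔run (x ∷ w) _ = mk⇔ (accepts⇒run x w) (λ (r , run) → run⇒accepts x w r run)
    where
    accepts⇒run : ∀ {q} x w → AcceptsFrom A q (x ∷ w) → ∃ (AcceptingRun A q (x ∷ w))
    accepts⇒run x [] (q' , t , f) =
      (λ _ → q') , record { first = λ { _ refl → t } ; next = λ _ _ () ; accept = f }
    accepts⇒run x (y ∷ w) (q' , t , acc) with accepts⇒run y w acc
    ... | r , run = r' , record { first = λ { _ refl → t } ; next = next' ; accept = accept }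
      where
      open AcceptingRun run
      r' : ℕ → Fin k
      r' zero    = q'
      r' (suc p) = r p
      next' : ∀ p z → (x ∷ y ∷ w) ! suc p ≐ z → δ A (r' p) z (r' (suc p)) ≡ true
      next' zero    = first
      next' (suc p) = next p

    run⇒accepts : ∀ {q} x w r → AcceptingRun A q (x ∷ w) r → AcceptsFrom A q (x ∷ w)
    run⇒accepts x []      r run = r 0 , first x refl , accept
      where open AcceptingRun run
    run⇒accepts x (y ∷ w) r run =
      r 0 , first x refl ,
      run⇒accepts y w (r ∘ suc) (record { first = next 0 ; next = next ∘ suc ; accept = accept })
      where open AcceptingRun run

record LeafEnumeration {n} (dir : Dir) (a b : Fin n) : Set where
  field
    leafAt          : ℕ → Fin n
    leafAt-∈        : ∀ p → a ≤ leafAt p × leafAt p ≤ b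
    pos-leafAt      : ∀ p → p ℕ.≤ toℕ b ∸ toℕ a → pos dir a b (leafAt p) ≡ p
    leafAt-L        : leafAt 0 ≡ Lpt dir a b
    leafAt-R        : leafAt (toℕ b ∸ toℕ a) ≡ Rpt dir a b
    leafAt-adjacent : ∀ p → p ℕ.< toℕ b ∸ toℕ a →
                      Adjacent (leafAt p) (leafAt (suc p)) ⊎ Adjacent (leafAt (suc p)) (leafAt p)
    pos-adjacent    : ∀ {c c'} → a ≤ c → c' ≤ b → Adjacent c c' →
                      pos dir a b c' ≡ suc (pos dir a b c) ⊎ pos dir a b c ≡ suc (pos dir a b c')

module _ {n} {a b : Fin n} (a≤b : a ≤ b) where

  private
    M : ℕ
    M = toℕ b ∸ toℕ a

    M≤b : M ℕ.≤ toℕ b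
    M≤b = ℕₚ.m∸n≤m (toℕ b) (toℕ a)

    point : (t : ℕ) → t ℕ.≤ toℕ b → Fin n
    point t t≤b = fromℕ< (ℕₚ.≤-<-trans t≤b (Finₚ.toℕ<n b))

  -- Indices past the R-leaf are clamped to it.
  enumeration-L-at-a : LeafEnumeration L-at-a a b
  enumeration-L-at-a = record
    { leafAt          = leafAt
    ; leafAt-∈        = λ p → ℕₚ.≤-trans (ℕₚ.m≤m+n (toℕ a) _)
                                            (ℕₚ.≤-reflexive (≡.sym (toℕ-leafAt p)))
                            , ℕₚ.≤-trans (ℕₚ.≤-reflexive (toℕ-leafAt p)) (a+p≤b p)
    ; pos-leafAt      = λ p p≤M → trans (cong (_∸ toℕ a) (toℕ-leafAt≤ p p≤M)) (ℕₚ.m+n∸m≡n (toℕ a) p)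
    ; leafAt-L        = Finₚ.toℕ-injective (trans (toℕ-leafAt≤ 0 z≤n) (ℕₚ.+-identityʳ (toℕ a)))
    ; leafAt-R        = Finₚ.toℕ-injective (trans (toℕ-leafAt≤ M ℕₚ.≤-refl) (ℕₚ.m+[n∸m]≡n a≤b))
    ; leafAt-adjacent = λ p p<M → inj₁ (begin
        toℕ (leafAt (suc p)) ≡⟨ toℕ-leafAt≤ (suc p) p<M ⟩
        toℕ a + suc p        ≡⟨ ℕₚ.+-suc (toℕ a) p ⟩
        suc (toℕ a + p)      ≡⟨ cong suc (toℕ-leafAt≤ p (ℕₚ.<⇒≤ p<M)) ⟨
        suc (toℕ (leafAt p)) ∎)
    ; pos-adjacent    = λ a≤c _ adj → inj₁ (trans (cong (_∸ toℕ a) adj) (ℕₚ.+-∸-assoc 1 a≤c))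
    }
    where
    open ≡.≡-Reasoning
    a+p≤b : ∀ p → toℕ a + (p ⊓ M) ℕ.≤ toℕ b
    a+p≤b p = ℕₚ.≤-trans (ℕₚ.+-monoʳ-≤ (toℕ a) (ℕₚ.m⊓n≤n p M)) (ℕₚ.≤-reflexive (ℕₚ.m+[n∸m]≡n a≤b))
    leafAt : ℕ → Fin n
    leafAt p = point (toℕ a + (p ⊓ M)) (a+p≤b p)
    toℕ-leafAt : ∀ p → toℕ (leafAt p) ≡ toℕ a + (p ⊓ M)
    toℕ-leafAt p = Finₚ.toℕ-fromℕ< _
    toℕ-leafAt≤ : ∀ p → p ℕ.≤ M → toℕ (leafAt p) ≡ toℕ a + p
    toℕ-leafAt≤ p p≤M = trans (toℕ-leafAt p) (cong (toℕ a +_) (ℕₚ.m≤n⇒m⊓n≡m p≤M))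

  enumeration-L-at-b : LeafEnumeration L-at-b a b
  enumeration-L-at-b = record
    { leafAt          = leafAt
    ; leafAt-∈        = λ p → ℕₚ.≤-trans (ℕₚ.≤-reflexive (≡.sym (ℕₚ.m∸[m∸n]≡n a≤b)))
                                (ℕₚ.≤-trans (ℕₚ.∸-monoʳ-≤ (toℕ b) (ℕₚ.m⊓n≤n p M))
                                            (ℕₚ.≤-reflexive (≡.sym (toℕ-leafAt p))))
                            , ℕₚ.≤-trans (ℕₚ.≤-reflexive (toℕ-leafAt p)) (ℕₚ.m∸n≤m (toℕ b) (p ⊓ M))
    ; pos-leafAt      = λ p p≤M → trans (cong (toℕ b ∸_) (toℕ-leafAt≤ p p≤M))
                                        (ℕₚ.m∸[m∸n]≡n (ℕₚ.≤-trans p≤M M≤b))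
    ; leafAt-L        = Finₚ.toℕ-injective (toℕ-leafAt 0)
    ; leafAt-R        = Finₚ.toℕ-injective (trans (toℕ-leafAt≤ M ℕₚ.≤-refl) (ℕₚ.m∸[m∸n]≡n a≤b))
    ; leafAt-adjacent = λ p p<M → inj₂ (begin
        toℕ (leafAt p)               ≡⟨ toℕ-leafAt≤ p (ℕₚ.<⇒≤ p<M) ⟩
        toℕ b ∸ p                    ≡⟨ ℕₚ.+-∸-assoc 1 (ℕₚ.≤-trans p<M M≤b) ⟩
        suc (toℕ b ∸ suc p)          ≡⟨ cong suc (toℕ-leafAt≤ (suc p) p<M) ⟨
        suc (toℕ (leafAt (suc p)))   ∎)
    ; pos-adjacent    = λ {c} {c'} _ c'≤b adj → inj₂ (begin
        toℕ b ∸ toℕ c                ≡⟨ ℕₚ.+-∸-assoc 1 (subst (ℕ._≤ toℕ b) adj c'≤b) ⟩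
        suc (toℕ b ∸ suc (toℕ c))    ≡⟨ cong (λ t → suc (toℕ b ∸ t)) adj ⟨
        suc (toℕ b ∸ toℕ c')         ∎)
    }
    where
    open ≡.≡-Reasoning
    leafAt : ℕ → Fin n
    leafAt p = point (toℕ b ∸ (p ⊓ M)) (ℕₚ.m∸n≤m (toℕ b) (p ⊓ M))
    toℕ-leafAt : ∀ p → toℕ (leafAt p) ≡ toℕ b ∸ (p ⊓ M)
    toℕ-leafAt p = Finₚ.toℕ-fromℕ< _
    toℕ-leafAt≤ : ∀ p → p ℕ.≤ M → toℕ (leafAt p) ≡ toℕ b ∸ p
    toℕ-leafAt≤ p p≤M = trans (toℕ-leafAt p) (cong (toℕ b ∸_) (ℕₚ.m≤n⇒m⊓n≡m p≤M))

enumeration : ∀ {n} dir {a b : Fin n} → a ≤ b → LeafEnumeration dir a b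
enumeration L-at-a = enumeration-L-at-a
enumeration L-at-b = enumeration-L-at-b

module Encoding {m k} (A : Automaton m k) where

  transition : Fin 3 → Fin k → Fin m → Fin k → Formula (Var m k)
  transition j q x q' =
    short ∧f ((⟨D⟩ (var (s j) ∧f var (st q)))
          ∧f (⟨D⟩ (var (s (succ₃ j)) ∧f (var (sym x) ∧f var (st q')))))

  start : Fin k → Fin m → Formula (Var m k)
  start q x = var L ∧f (var (sym x) ∧f var (st q))

  end : Fin k → Formula (Var m k)
  end q = var R ∧f var (st q)

  badStart : Fin k → Fin m → Formula (Var m k)
  badStart q x = unless (δ A (q0 A) x q) (start q x)

  badEnd : Fin k → Formula (Var m k)
  badEnd q = unless (F A q) (end q)

  badStep : Fin 3 → Fin k → Fin m → Fin k → Formula (Var m k)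
  badStep j q x q' = unless (δ A q x q') (transition j q x q')

  badSteps : Fin 3 → Formula (Var m k)
  badSteps j = ⋁ k λ q → ⋁ m λ x → ⋁ k (badStep j q x)

  stateless bad ψ : Formula (Var m k)
  stateless = leaf ∧f (¬f (⋁ k (var ∘ st)))
  bad       = stateless ∨f ((⋁ k λ q → ⋁ m (badStart q)) ∨f (⋁ k badEnd ∨f ⋁ 3 badSteps))
  ψ         = □ (¬f bad)

  module _ {n} (γ : Labeling n (Var m k)) where

    record Clean (c d : Fin n) : Set where
      field
        stateful : ¬ Sat γ c d stateless
        start-ok : ∀ q x → Sat γ c d (start q x) → δ A (q0 A) x q ≡ true
        end-ok   : ∀ q → Sat γ c d (end q) → F A q ≡ true
        step-ok  : ∀ j q x q' → Sat γ c d (transition j q x q') → δ A q x q' ≡ true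

    ¬bad⇔clean : ∀ {c d} → (¬ Sat γ c d bad) ⇔ Clean c d
    ¬bad⇔clean = mk⇔ ⇒ ⇐
      where
      ⇒ : ∀ {c d} → ¬ Sat γ c d bad → Clean c d
      ⇒ ¬bad = record
        { stateful = ¬bad ∘ inj₁
        ; start-ok = λ q x → to (¬-unless γ _ _) (to (¬-⋁ γ m _)
                       (to (¬-⋁ γ k _) (¬bad ∘ inj₂ ∘ inj₁) q) x)
        ; end-ok   = λ q → to (¬-unless γ _ _) (to (¬-⋁ γ k _) (¬bad ∘ inj₂ ∘ inj₂ ∘ inj₁) q)
        ; step-ok  = λ j q x q' → to (¬-unless γ _ _) (to (¬-⋁ γ k _) (to (¬-⋁ γ m _)
                       (to (¬-⋁ γ k _) (to (¬-⋁ γ 3 badSteps)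
                         (¬bad ∘ inj₂ ∘ inj₂ ∘ inj₂) j) q) x) q')
        }
      ⇐ : ∀ {c d} → Clean c d → ¬ Sat γ c d bad
      ⇐ clean (inj₁ sl) = Clean.stateful clean sl
      ⇐ clean (inj₂ (inj₁ bs)) =
        from (¬-⋁ γ k _) (λ q → from (¬-⋁ γ m _) λ x →
          from (¬-unless γ _ _) (Clean.start-ok clean q x)) bs
      ⇐ clean (inj₂ (inj₂ (inj₁ be))) =
        from (¬-⋁ γ k _) (λ q → from (¬-unless γ _ _) (Clean.end-ok clean q)) be
      ⇐ clean (inj₂ (inj₂ (inj₂ bt))) =
        from (¬-⋁ γ 3 badSteps) (λ j → from (¬-⋁ γ k _) λ q → from (¬-⋁ γ m _) λ x →
          from (¬-⋁ γ k _) λ q' → from (¬-unless γ _ _) (Clean.step-ok clean j q x q')) bt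

    Sat-ψ : ∀ {a b} → a ≤ b →
            Sat γ a b ψ ⇔ (∀ c d → a ≤ c → c ≤ d → d ≤ b → Clean c d)
    Sat-ψ a≤b = mk⇔
      (λ sat c d a≤c c≤d d≤b → to ¬bad⇔clean (to (Sat-□¬ γ bad a≤b) sat c d a≤c c≤d d≤b))
      (λ clean → from (Sat-□¬ γ bad a≤b) λ c d a≤c c≤d d≤b →
                   from ¬bad⇔clean (clean c d a≤c c≤d d≤b))

module Correctness {m k} (A : Automaton m k) {n} {γ : Labeling n (Var m k)} {a b : Fin n}
                   {dir : Dir} {w : List (Fin m)}
                   (a≤b : a ≤ b) (O : Oriented dir γ a b) (W : Written dir γ a b w) where

  open Encoding A
  open Oriented O
  open Written W
  open LeafEnumeration (enumeration dir a≤b)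

  private
    M : ℕ
    M = toℕ b ∸ toℕ a

    position : Fin n → ℕ
    position = pos dir a b

  !suc≐⇒<M : ∀ {p x} → w ! suc p ≐ x → p ℕ.< M
  !suc≐⇒<M {p} w!1+p = ℕ.s≤s⁻¹ (subst (suc p ℕ.<_) len (!≐⇒<length w w!1+p))

  pos-L : position (Lpt dir a b) ≡ 0
  pos-L = trans (cong position (≡.sym leafAt-L)) (pos-leafAt 0 z≤n)

  pos-R : position (Rpt dir a b) ≡ M
  pos-R = trans (cong position (≡.sym leafAt-R)) (pos-leafAt M ℕₚ.≤-refl)

  s-leaf-mod₃ : ∀ {c} → a ≤ c → c ≤ b → ∀ j → (γ c c (s j) ≡ true) ⇔ (j ≡ mod₃ (position c))
  s-leaf-mod₃ {c} a≤c c≤b j = mk⇔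
    (λ sj → Finₚ.toℕ-injective (trans (to (s-leaf c a≤c c≤b j) sj) (≡.sym (toℕ-mod₃ (position c)))))
    (λ j≡ → from (s-leaf c a≤c c≤b j) (trans (cong toℕ j≡) (toℕ-mod₃ (position c))))

  s-labels-leaf : ∀ {c d j} → a ≤ c → c ≤ d → d ≤ b → γ c d (s j) ≡ true → c ≡ d
  s-labels-leaf {c} {d} {j} a≤c c≤d d≤b sj with c ≟ d
  ... | yes c≡d = c≡d
  ... | no c≢d with trans (≡.sym sj) (s-only c d a≤c c≤d d≤b c≢d j)
  ...   | ()

  pos-close : ∀ {c₁ c₂} → a ≤ c₁ → c₁ ≤ b → a ≤ c₂ → c₂ ≤ b →
              c₁ ≡ c₂ ⊎ Adjacent c₁ c₂ ⊎ Adjacent c₂ c₁ →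
              position c₁ ≡ position c₂ ⊎ position c₂ ≡ suc (position c₁)
                                        ⊎ position c₁ ≡ suc (position c₂)
  pos-close _ _ _ _ (inj₁ refl) = inj₁ refl
  pos-close a≤c₁ _ _ c₂≤b (inj₂ (inj₁ adj)) with pos-adjacent a≤c₁ c₂≤b adj
  ... | inj₁ e = inj₂ (inj₁ e)
  ... | inj₂ e = inj₂ (inj₂ e)
  pos-close _ c₁≤b a≤c₂ _ (inj₂ (inj₂ adj)) with pos-adjacent a≤c₂ c₁≤b adj
  ... | inj₁ e = inj₂ (inj₂ e)
  ... | inj₂ e = inj₂ (inj₁ e)

  successive-leaves : ∀ {c d c₁ c₂ j} → a ≤ c → d ≤ b → toℕ d ℕ.≤ suc (toℕ c) →
                      c ≤ c₁ → c₁ ≤ d → c ≤ c₂ → c₂ ≤ d →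
                      γ c₁ c₁ (s j) ≡ true → γ c₂ c₂ (s (succ₃ j)) ≡ true →
                      position c₂ ≡ suc (position c₁)
  successive-leaves {j = j} a≤c d≤b d≤1+c c≤c₁ c₁≤d c≤c₂ c₂≤d j₁ j₂ = mod₃-successor
    (pos-close a≤c₁ c₁≤b a≤c₂ c₂≤b (points-of-short d≤1+c c≤c₁ c₁≤d c≤c₂ c₂≤d))
    (trans (≡.sym (to (s-leaf-mod₃ a≤c₂ c₂≤b (succ₃ j)) j₂))
           (cong succ₃ (to (s-leaf-mod₃ a≤c₁ c₁≤b j) j₁)))
    where
    a≤c₁ = Finₚ.≤-trans a≤c c≤c₁
    a≤c₂ = Finₚ.≤-trans a≤c c≤c₂
    c₁≤b = Finₚ.≤-trans c₁≤d d≤b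
    c₂≤b = Finₚ.≤-trans c₂≤d d≤b

  module Soundness (ρ : Fin n → Fin n → Fin k → Bool) (sat : Sat (updQ γ ρ) a b ψ) where

    private
      γ' = updQ γ ρ
      ℓ = leafAt

      a≤ℓ : ∀ p → a ≤ ℓ p
      a≤ℓ = proj₁ ∘ leafAt-∈

      ℓ≤b : ∀ p → ℓ p ≤ b
      ℓ≤b = proj₂ ∘ leafAt-∈

      clean : ∀ {c d} → a ≤ c → c ≤ d → d ≤ b → Clean γ' c d
      clean = to (Sat-ψ γ' a≤b) sat _ _

      clean-leaf : ∀ p → Clean γ' (ℓ p) (ℓ p)
      clean-leaf p = clean (a≤ℓ p) Finₚ.≤-refl (ℓ≤b p)

    state-at : ∀ p → ∃ λ q → ρ (ℓ p) (ℓ p) q ≡ true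
    state-at p with Finₚ.any? (λ q → ρ (ℓ p) (ℓ p) q ≟ᵇ true)
    ... | yes found = found
    ... | no none   = ⊥-elim (Clean.stateful (clean-leaf p)
                        (leaf-sat γ' (ℓ p) , from (¬-⋁ γ' k (var ∘ st)) (λ q ρq → none (q , ρq))))

    r : ℕ → Fin k
    r = proj₁ ∘ state-at

    r-at : ∀ p → ρ (ℓ p) (ℓ p) (r p) ≡ true
    r-at = proj₂ ∘ state-at

    letter-at : ∀ {p x} → p ℕ.≤ M → w ! p ≐ x → γ (ℓ p) (ℓ p) (sym x) ≡ true
    letter-at {p} {x} p≤M w!p = from (leaves (ℓ p) (a≤ℓ p) (ℓ≤b p) x)
      (subst (λ i → w ! i ≐ x) (≡.sym (pos-leafAt p p≤M)) w!p)

    counter-at : ∀ {p} → p ℕ.≤ M → γ (ℓ p) (ℓ p) (s (mod₃ p)) ≡ true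
    counter-at {p} p≤M = from (s-leaf-mod₃ (a≤ℓ p) (ℓ≤b p) (mod₃ p))
      (cong mod₃ (≡.sym (pos-leafAt p p≤M)))

    first : ∀ x → w ! 0 ≐ x → δ A (q0 A) x (r 0) ≡ true
    first x w!0 = Clean.start-ok (clean-leaf 0) (r 0) x
      (subst (λ c → γ c c L ≡ true) (≡.sym leafAt-L) L-leaf , letter-at z≤n w!0 , r-at 0)

    accept : F A (r (ℕ.pred (length w))) ≡ true
    accept rewrite len = Clean.end-ok (clean-leaf M) (r M)
      (subst (λ c → γ c c R ≡ true) (≡.sym leafAt-R) R-leaf , r-at M)

    step-between : ∀ {p x lo hi} → p ℕ.< M → w ! suc p ≐ x →
                   Adjacent lo hi → a ≤ lo → hi ≤ b →
                   ℓ p ≡ lo ⊎ ℓ p ≡ hi → ℓ (suc p) ≡ lo ⊎ ℓ (suc p) ≡ hi →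
                   δ A (r p) x (r (suc p)) ≡ true
    step-between {p} {x} p<M w!1+p adj a≤lo hi≤b p∈ 1+p∈ =
      Clean.step-ok (clean a≤lo (adjacent⇒≤ adj) hi≤b) (mod₃ p) (r p) x (r (suc p))
        ( short-sat γ' adj
        , ⟨D⟩-endpoint γ' (var (s (mod₃ p)) ∧f var (st (r p))) adj p∈
            (counter-at (ℕₚ.<⇒≤ p<M) , r-at p)
        , ⟨D⟩-endpoint γ' (var (s (mod₃ (suc p))) ∧f (var (sym x) ∧f var (st (r (suc p)))))
            adj 1+p∈ (counter-at p<M , letter-at p<M w!1+p , r-at (suc p)))

    next : ∀ p x → w ! suc p ≐ x → δ A (r p) x (r (suc p)) ≡ true
    next p x w!1+p with leafAt-adjacent p (!suc≐⇒<M w!1+p)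
    ... | inj₁ adj = step-between (!suc≐⇒<M w!1+p) w!1+p adj
                       (a≤ℓ p) (ℓ≤b (suc p)) (inj₁ refl) (inj₂ refl)
    ... | inj₂ adj = step-between (!suc≐⇒<M w!1+p) w!1+p adj
                       (a≤ℓ (suc p)) (ℓ≤b p) (inj₂ refl) (inj₁ refl)

    run : AcceptingRun A (q0 A) w r
    run = record { first = first ; next = next ; accept = accept }

  runLabeling : (ℕ → Fin k) → Fin n → Fin n → Fin k → Bool
  runLabeling r c _ q = does (q ≟ r (position c))

  module Completeness (r : ℕ → Fin k) (run : AcceptingRun A (q0 A) w r) where

    open AcceptingRun run

    private
      γ' = updQ γ (runLabeling r)

    state-of : ∀ c {q} → does (q ≟ r (position c)) ≡ true → q ≡ r (position c)
    state-of c {q} e with q ≟ r (position c)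
    ... | yes q≡rc = q≡rc
    state-of c () | no _

    stateful : ∀ {c d} → ¬ Sat γ' c d stateless
    stateful {c} (_ , no-state) =
      to (¬-⋁ γ' k (var ∘ st)) no-state (r (position c)) (dec-true (r (position c) ≟ _) refl)

    start-ok : ∀ {c d} → a ≤ c → c ≤ d → d ≤ b →
               ∀ q x → Sat γ' c d (start q x) → δ A (q0 A) x q ≡ true
    start-ok {c} {d} a≤c c≤d d≤b q x (L-cd , x-cd , q-cd) =
      subst (λ q → δ A (q0 A) x q ≡ true) (≡.sym (trans (state-of c q-cd) (cong r c-at-0)))
        (first x (subst (λ i → w ! i ≐ x) c-at-0 (to (leaves c a≤c (Finₚ.≤-trans c≤d d≤b) x) x-cc)))
      where
      c≡L,d≡L = L-only c d a≤c c≤d d≤b L-cd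
      c-at-0 : position c ≡ 0
      c-at-0 = trans (cong position (proj₁ c≡L,d≡L)) pos-L
      x-cc : γ c c (sym x) ≡ true
      x-cc = subst (λ d → γ c d (sym x) ≡ true) (trans (proj₂ c≡L,d≡L) (≡.sym (proj₁ c≡L,d≡L))) x-cd

    end-ok : ∀ {c d} → a ≤ c → c ≤ d → d ≤ b → ∀ q → Sat γ' c d (end q) → F A q ≡ true
    end-ok {c} {d} a≤c c≤d d≤b q (R-cd , q-cd) =
      subst (λ q → F A q ≡ true) (≡.sym (trans (state-of c q-cd) (cong r c-at-M)))
        (subst (λ i → F A (r i) ≡ true) (cong ℕ.pred len) accept)
      where
      c-at-M : position c ≡ M
      c-at-M = trans (cong position (proj₁ (R-only c d a≤c c≤d d≤b R-cd))) pos-R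

    step-at : ∀ {c₁ c₂ j q x q'} → a ≤ c₂ → c₂ ≤ b → position c₂ ≡ suc (position c₁) →
              Sat γ' c₁ c₁ (var (s j) ∧f var (st q)) →
              Sat γ' c₂ c₂ (var (s (succ₃ j)) ∧f (var (sym x) ∧f var (st q'))) →
              δ A q x q' ≡ true
    step-at {c₁} {c₂} {x = x} a≤c₂ c₂≤b successor (_ , q₁) (_ , x₂ , q₂) =
      ≡.subst₂ (λ q q' → δ A q x q' ≡ true)
        (≡.sym (state-of c₁ q₁)) (≡.sym (trans (state-of c₂ q₂) (cong r successor)))
        (next (position c₁) x (subst (λ i → w ! i ≐ x) successor (to (leaves c₂ a≤c₂ c₂≤b x) x₂)))

    step-ok : ∀ {c d} → a ≤ c → c ≤ d → d ≤ b →
              ∀ j q x q' → Sat γ' c d (transition j q x q') → δ A q x q' ≡ true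
    step-ok a≤c c≤d d≤b j q x q'
      ( short-cd
      , (c₁ , d₁ , c≤c₁ , c₁≤d₁ , d₁≤d , _ , sat₁)
      , (c₂ , d₂ , c≤c₂ , c₂≤d₂ , d₂≤d , _ , sat₂))
      with s-labels-leaf (Finₚ.≤-trans a≤c c≤c₁) c₁≤d₁ (Finₚ.≤-trans d₁≤d d≤b) (proj₁ sat₁)
         | s-labels-leaf (Finₚ.≤-trans a≤c c≤c₂) c₂≤d₂ (Finₚ.≤-trans d₂≤d d≤b) (proj₁ sat₂)
    ... | refl | refl =
      step-at (Finₚ.≤-trans a≤c c≤c₂) (Finₚ.≤-trans d₂≤d d≤b)
        (successive-leaves a≤c d≤b (short-bound γ' c≤d short-cd) c≤c₁ d₁≤d c≤c₂ d₂≤d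
          (proj₁ sat₁) (proj₁ sat₂))
        sat₁ sat₂

    sat : Sat γ' a b ψ
    sat = from (Sat-ψ γ' a≤b) λ c d a≤c c≤d d≤b → record
      { stateful = stateful
      ; start-ok = start-ok a≤c c≤d d≤b
      ; end-ok   = end-ok a≤c c≤d d≤b
      ; step-ok  = step-ok a≤c c≤d d≤b
      }

mainTheorem3 : ∀ {m k : ℕ} (A : Automaton m k)
    → Σ (Formula (Var m k)) λ ψ
      → ∀ (n : ℕ) (γ : Labeling n (Var m k)) (a b : Fin n) (dir : Dir)
          (w : List (Fin m))
      → a ≤ b
      → Oriented dir γ a b
      → Written dir γ a b w
      → (∃ λ (ρ : Fin n → Fin n → Fin k → Bool) → Sat (updQ γ ρ) a b ψ)
        ⇔ Accepts A w
mainTheorem3 A = Encoding.ψ A , λ n γ a b dir w a≤b O W →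
  let open Correctness A a≤b O W
      accepts⇔run = acceptsFrom⇔run A w
                      (subst (0 ℕ.<_) (≡.sym (Written.len W)) (s≤s z≤n))
  in mk⇔ (λ (ρ , sat) → from accepts⇔run (_ , Soundness.run ρ sat))
         (λ accepts → let (r , run) = to accepts⇔run accepts
                      in runLabeling r , Completeness.sat r run)
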